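{- Let $q$ be a prime power and let $Q^+(7,q)$ be a non-degenerate hyperbolic quadric of ${\rm PG}(7,q)$. If a solid $\pi_3$ of ${\rm PG}(7,q)$ meets $Q^+(7,q)$ in an elliptic quadric $Q^-(3,q)$, then the point set of this $Q^-(3,q)$ is a maximal partial ovoid of $Q^+(7,q)$.
   Context: A partial ovoid of $Q^+(7,q)$ is a set of points of the quadric no two of which span a line contained in the quadric; it is maximal if it is not properly contained in a larger partial ovoid. An elliptic quadric $Q^-(3,q)$ is a non-degenerate quadric of elliptic type in a solid (it has $q^2+1$ points and contains no lines). -}

module Defs where

open import Level using (0ℓ)
open import Data.Nat using (ℕ; zero; suc)
open import Data.Fin using (Fin; zero; suc; #_)
open import Data.Product using (Σ; Σ-syntax; ∃; ∃-syntax; _×_; _,_)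
open import Data.Sum using (_⊎_)
open import Relation.Nullary using (¬_)
open import Relation.Binary.PropositionalEquality using (_≡_)
open import Algebra.Structures using (IsCommutativeRing)
open import Function.Bundles using (_↔_)


-- A finite field with q elements (q is then automatically a prime power),
-- with propositional equality on the carrier.
record FiniteField : Set₁ where
  infixl 6 _+_
  infixl 7 _*_
  field
    F        : Set
    _+_ _*_  : F → F → F
    -_       : F → F
    0# 1#    : F
    isCommutativeRing : IsCommutativeRing _≡_ _+_ _*_ -_ 0# 1#
    0≢1      : ¬ (0# ≡ 1#)
    inverse  : (x : F) → ¬ (x ≡ 0#) → Σ[ y ∈ F ] (x * y ≡ 1#)
    q        : ℕ
    enum     : F ↔ Fin q

module Geometry (𝔽 : FiniteField) where
  open FiniteField 𝔽

  V : ℕ → Set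
  V n = Fin n → F

  Σᶠ : ∀ {n} → (Fin n → F) → F
  Σᶠ {zero}  f = 0#
  Σᶠ {suc n} f = f zero + Σᶠ (λ i → f (suc i))

  Mat : ℕ → ℕ → Set
  Mat n m = Fin n → Fin m → F

  apply : ∀ {n m} → Mat n m → V m → V n
  apply M x i = Σᶠ (λ j → M i j * x j)

  zeroV : ∀ {n} → V n
  zeroV _ = 0#

  _≐_ : ∀ {n} → V n → V n → Set
  u ≐ v = ∀ i → u i ≡ v i

  NonZero : ∀ {n} → V n → Set
  NonZero v = ¬ (v ≐ zeroV)

  Invertible : ∀ {n} → Mat n n → Set
  Invertible {n} M = Σ[ N ∈ Mat n n ] (∀ x → apply M (apply N x) ≐ x) × (∀ x → apply N (apply M x) ≐ x)

  QForm : ℕ → Set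
  QForm n = Mat n n

  evalQ : ∀ {n} → QForm n → V n → F
  evalQ A x = Σᶠ (λ i → Σᶠ (λ j → A i j * x i * x j))

  hyperbolic8 : V 8 → F
  hyperbolic8 x = x (# 0) * x (# 1) + x (# 2) * x (# 3) + x (# 4) * x (# 5) + x (# 6) * x (# 7)

  -- Q defines a non-degenerate hyperbolic quadric Q⁺(7,q) of PG(7,q):
  -- it is equivalent under an invertible linear change of coordinates to the standard form
  IsHyperbolic7 : QForm 8 → Set
  IsHyperbolic7 A = Σ[ M ∈ Mat 8 8 ] Invertible M × (∀ x → evalQ A (apply M x) ≡ hyperbolic8 x)

  Anisotropic : F → F → F → Set
  Anisotropic a b c = ∀ x y → a * x * x + b * x * y + c * y * y ≡ 0# → (x ≡ 0#) × (y ≡ 0#)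

  -- a solid π₃ of PG(7,q): the image of an injective linear map F^4 → F^8
  IsSolid : Mat 8 4 → Set
  IsSolid E = ∀ y → apply E y ≐ zeroV → y ≐ zeroV

  -- the solid with basis matrix E meets the quadric (form A) in an elliptic quadric Q⁻(3,q):
  -- the restricted form is, in suitable coordinates of the solid,
  -- y0 y1 + a y2² + b y2 y3 + c y3² with a y2² + b y2 y3 + c y3² anisotropic
  MeetsInElliptic : QForm 8 → Mat 8 4 → Set
  MeetsInElliptic A E =
    Σ[ N ∈ Mat 4 4 ] Invertible N × (Σ[ a ∈ F ] Σ[ b ∈ F ] Σ[ c ∈ F ] Anisotropic a b c ×
      (∀ y → evalQ A (apply E (apply N y)) ≡ y (# 0) * y (# 1) + a * y (# 2) * y (# 2) + b * y (# 2) * y (# 3) + c * y (# 3) * y (# 3)))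

  -- points of PG(n-1,q) are nonzero vectors up to nonzero scalars
  SamePoint : ∀ {n} → V n → V n → Set
  SamePoint u v = Σ[ λ' ∈ F ] (¬ (λ' ≡ 0#)) × (∀ i → v i ≡ λ' * u i)

  OnQuadric : ∀ {n} → QForm n → V n → Set
  OnQuadric A v = NonZero v × (evalQ A v ≡ 0#)

  LineInQuadric : ∀ {n} → QForm n → V n → V n → Set
  LineInQuadric A u v = ∀ s t → evalQ A (λ i → s * u i + t * v i) ≡ 0#

  -- a set of points (given as a predicate on vector representatives)
  PointSet : ℕ → Set₁
  PointSet n = V n → Set

  PartialOvoid : ∀ {n} → QForm n → PointSet n → Set
  PartialOvoid A P =
    (∀ v → P v → OnQuadric A v) ×
    (∀ u v → P u → P v → ¬ SamePoint u v → ¬ LineInQuadric A u v)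

  MaximalPartialOvoid : ∀ {n} → QForm n → PointSet n → Set₁
  MaximalPartialOvoid {n} A P =
    PartialOvoid A P ×
    ((P' : PointSet n) → (∀ v → P v → P' v) → PartialOvoid A P' → ∀ v → P' v → P v)

  SolidSection : QForm 8 → Mat 8 4 → PointSet 8
  SolidSection A E v = (Σ[ y ∈ V 4 ] (apply E y ≐ v)) × OnQuadric A v

{-# OPTIONS --safe #-}
-- In coordinates of the solid adapted to the elliptic quadric, the form is y₀y₁ + f(y₂, y₃) with f
-- anisotropic.  No line lies on it: a second point of a line through x with x₀ ≠ 0 can be chosen
-- with y₀ = 0, then anisotropy forces it onto the y₁-axis, and y₁ = 0 follows from the line
-- through x.  For maximality, let v be a point of the quadric outside the section.  Its polar
-- hyperplane meets the solid in at least a plane, and every plane of the solid meets Q⁻(3,q):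
-- eliminating y₁ leaves a ternary quadratic form, isotropic over a finite field by a square
-- root (q even) or by completing squares and pigeonhole (q odd).  Such a point w of the section
-- is collinear on the quadric with v, contradicting that the larger set is a partial ovoid.
module Submission where

open import Defs
open import Data.Product using (_×_)
open import Data.Product using (Σ-syntax; ∃; ∃₂; _,_; proj₁; proj₂)
open import Data.Sum using (_⊎_; inj₁; inj₂; [_,_]′; reduce)
open import Data.Empty using (⊥-elim)
open import Data.Maybe using (Maybe; just; nothing)
open import Data.Nat as ℕ using (ℕ; zero; suc)
import Data.Nat.Properties as ℕ
open import Data.Integer as ℤ using (ℤ; -[1+_]; _⊖_)
import Data.Integer.Properties as ℤ
open import Data.Fin as Fin using (Fin; zero; suc; #_)
import Data.Fin.Properties as Fin
open import Data.Vec.Functional using (_∷_; [])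
open import Function using (_∘_; id; case_of_)
open import Function.Bundles using (Inverse; Injection)
open import Function.Properties.Inverse using (Inverse⇒Injection; ↔-sym)
open import Relation.Binary.PropositionalEquality
open import Relation.Nullary using (¬_; Dec; yes; no; ¬?; _×-dec_)
open import Relation.Nullary.Decidable using (map′)
open import Algebra.Bundles using (CommutativeRing)
import Algebra.Properties.Ring as RingProperties
import Algebra.Properties.CommutativeSemigroup as CommutativeSemigroupProperties
import Algebra.Properties.Semiring.Mult.TCOptimised as SemiringMultiplication
open import Algebra.Solver.Ring.AlmostCommutativeRing
  using (fromCommutativeRing; _-Raw-AlmostCommutative⟶_)
import Algebra.Solver.Ring as RingSolver

module _ (𝔽 : FiniteField) where
  open FiniteField 𝔽
  open Geometry 𝔽
  open ≡-Reasoning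

  commutativeRing : CommutativeRing _ _
  commutativeRing = record { isCommutativeRing = isCommutativeRing }

  open CommutativeRing commutativeRing
    using (+-comm; *-assoc; distribˡ; +-identityˡ; +-identityʳ; -‿inverseʳ; *-identityʳ; zeroˡ; zeroʳ; ring; semiring; +-commutativeSemigroup)
  open RingProperties ring
    using (-‿distribˡ-*; -‿distribʳ-*; -‿involutive; -‿+-comm; -0#≈0#; x∙y⁻¹≈ε⇒x≈y; +-inverseʳ-unique; +-cancelˡ)

  open SemiringMultiplication semiring using () renaming (_×_ to _×ᶠ_; ×-homo-+ to ×ᶠ-homo-+; ×1-homo-* to ℕ⟦⟧-*)

  ℕ⟦_⟧ : ℕ → F
  ℕ⟦ n ⟧ = n ×ᶠ 1#

  ℕ⟦⟧-+ : ∀ m n → ℕ⟦ m ℕ.+ n ⟧ ≡ ℕ⟦ m ⟧ + ℕ⟦ n ⟧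
  ℕ⟦⟧-+ = ×ᶠ-homo-+ 1#

  ℤ⟦_⟧ : ℤ → F
  ℤ⟦ ℤ.+ n ⟧    = ℕ⟦ n ⟧
  ℤ⟦ -[1+ n ] ⟧ = - ℕ⟦ suc n ⟧

  ℤ⟦⊖⟧ : ∀ m n → ℤ⟦ m ⊖ n ⟧ ≡ ℕ⟦ m ⟧ + - ℕ⟦ n ⟧
  ℤ⟦⊖⟧ zero    zero    = sym (trans (+-identityˡ _) -0#≈0#)
  ℤ⟦⊖⟧ zero    (suc n) = sym (+-identityˡ _)
  ℤ⟦⊖⟧ (suc m) zero    = sym (trans (cong (ℕ⟦ suc m ⟧ +_) -0#≈0#) (+-identityʳ _))
  ℤ⟦⊖⟧ (suc m) (suc n) = begin
    ℤ⟦ suc m ⊖ suc n ⟧                      ≡⟨ cong ℤ⟦_⟧ (ℤ.[1+m]⊖[1+n]≡m⊖n m n) ⟩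
    ℤ⟦ m ⊖ n ⟧                              ≡⟨ ℤ⟦⊖⟧ m n ⟩
    ℕ⟦ m ⟧ + - ℕ⟦ n ⟧                       ≡⟨ sym (+-identityˡ _) ⟩
    0# + (ℕ⟦ m ⟧ + - ℕ⟦ n ⟧)                ≡⟨ cong (_+ (ℕ⟦ m ⟧ + - ℕ⟦ n ⟧)) (sym (-‿inverseʳ 1#)) ⟩
    (1# + - 1#) + (ℕ⟦ m ⟧ + - ℕ⟦ n ⟧)       ≡⟨ interchange 1# (- 1#) ℕ⟦ m ⟧ (- ℕ⟦ n ⟧) ⟩
    (1# + ℕ⟦ m ⟧) + (- 1# + - ℕ⟦ n ⟧)       ≡⟨ cong₂ (λ x y → x + y) (sym (ℕ⟦⟧-+ 1 m)) (-‿+-comm 1# _) ⟩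
    ℕ⟦ suc m ⟧ + - (1# + ℕ⟦ n ⟧)            ≡⟨ cong (λ x → ℕ⟦ suc m ⟧ + - x) (sym (ℕ⟦⟧-+ 1 n)) ⟩
    ℕ⟦ suc m ⟧ + - ℕ⟦ suc n ⟧               ∎
    where open CommutativeSemigroupProperties +-commutativeSemigroup using (interchange)

  ℤ⟦⟧-+ : ∀ i j → ℤ⟦ i ℤ.+ j ⟧ ≡ ℤ⟦ i ⟧ + ℤ⟦ j ⟧
  ℤ⟦⟧-+ (ℤ.+ m)  (ℤ.+ n)  = ℕ⟦⟧-+ m n
  ℤ⟦⟧-+ (ℤ.+ m)  -[1+ n ] = ℤ⟦⊖⟧ m (suc n)
  ℤ⟦⟧-+ -[1+ m ] (ℤ.+ n)  = trans (ℤ⟦⊖⟧ n (suc m)) (+-comm _ _)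
  ℤ⟦⟧-+ -[1+ m ] -[1+ n ] = begin
    - ℕ⟦ suc (suc (m ℕ.+ n)) ⟧            ≡⟨ cong (λ k → - ℕ⟦ suc k ⟧) (sym (ℕ.+-suc m n)) ⟩
    - ℕ⟦ suc m ℕ.+ suc n ⟧                ≡⟨ cong -_ (ℕ⟦⟧-+ (suc m) (suc n)) ⟩
    - (ℕ⟦ suc m ⟧ + ℕ⟦ suc n ⟧)           ≡⟨ sym (-‿+-comm _ _) ⟩
    - ℕ⟦ suc m ⟧ + - ℕ⟦ suc n ⟧           ∎

  ℤ⟦⟧-* : ∀ i j → ℤ⟦ i ℤ.* j ⟧ ≡ ℤ⟦ i ⟧ * ℤ⟦ j ⟧
  ℤ⟦⟧-* (ℤ.+ zero) j = sym (zeroˡ _)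
  ℤ⟦⟧-* i (ℤ.+ zero) = trans (cong ℤ⟦_⟧ (ℤ.*-zeroʳ i)) (sym (zeroʳ _))
  ℤ⟦⟧-* (ℤ.+ suc m) (ℤ.+ suc n) = ℕ⟦⟧-* (suc m) (suc n)
  ℤ⟦⟧-* (ℤ.+ suc m) -[1+ n ]    = trans (cong -_ (ℕ⟦⟧-* (suc m) (suc n))) (-‿distribʳ-* _ _)
  ℤ⟦⟧-* -[1+ m ] (ℤ.+ suc n)    = trans (cong -_ (ℕ⟦⟧-* (suc m) (suc n))) (-‿distribˡ-* _ _)
  ℤ⟦⟧-* -[1+ m ] -[1+ n ]       = begin
    ℕ⟦ suc m ℕ.* suc n ⟧            ≡⟨ ℕ⟦⟧-* (suc m) (suc n) ⟩
    ℕ⟦ suc m ⟧ * ℕ⟦ suc n ⟧         ≡⟨ sym (-‿involutive _) ⟩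
    - - (ℕ⟦ suc m ⟧ * ℕ⟦ suc n ⟧)   ≡⟨ cong -_ (-‿distribˡ-* _ _) ⟩
    - (- ℕ⟦ suc m ⟧ * ℕ⟦ suc n ⟧)   ≡⟨ -‿distribʳ-* _ _ ⟩
    - ℕ⟦ suc m ⟧ * - ℕ⟦ suc n ⟧     ∎

  ℤ⟦⟧-- : ∀ i → ℤ⟦ ℤ.- i ⟧ ≡ - ℤ⟦ i ⟧
  ℤ⟦⟧-- (ℤ.+ zero)  = sym -0#≈0#
  ℤ⟦⟧-- (ℤ.+ suc n) = refl
  ℤ⟦⟧-- -[1+ n ]    = sym (-‿involutive _)

  ℤ⟦⟧-homomorphism : ℤ.+-*-rawRing -Raw-AlmostCommutative⟶ fromCommutativeRing commutativeRing
  ℤ⟦⟧-homomorphism = record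
    { ⟦_⟧ = ℤ⟦_⟧ ; +-homo = ℤ⟦⟧-+ ; *-homo = ℤ⟦⟧-* ; -‿homo = ℤ⟦⟧-- ; 0-homo = refl ; 1-homo = refl }

  ℤ⟦⟧-≟ : ∀ i j → Maybe (ℤ⟦ i ⟧ ≡ ℤ⟦ j ⟧)
  ℤ⟦⟧-≟ i j with i ℤ.≟ j
  ... | yes refl = just refl
  ... | no _     = nothing

  open RingSolver ℤ.+-*-rawRing (fromCommutativeRing commutativeRing) ℤ⟦⟧-homomorphism ℤ⟦⟧-≟
    using (solve; _:=_; _:+_; _:*_; :-_; con; Polynomial)

  κ : ∀ {n} → ℕ → Polynomial n
  κ k = con (ℤ.+ k)

  two : F
  two = 1# + 1#

  open Inverse enum using (to; from; strictlyInverseʳ)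

  to-injective : ∀ {x y} → to x ≡ to y → x ≡ y
  to-injective = Injection.injective (Inverse⇒Injection enum)

  from-injective : ∀ {i j} → from i ≡ from j → i ≡ j
  from-injective = Injection.injective (Inverse⇒Injection (↔-sym enum))

  infix 4 _≟_
  _≟_ : (x y : F) → Dec (x ≡ y)
  x ≟ y = map′ to-injective (cong to) (to x Fin.≟ to y)

  ∃? : {P : F → Set} → (∀ x → Dec (P x)) → Dec (∃ P)
  ∃? {P} P? = map′ (λ (i , p) → from i , p) (λ (x , p) → to x , subst P (sym (strictlyInverseʳ x)) p) (Fin.any? (P? ∘ from))

  SamePoint? : ∀ {n} (u v : V n) → Dec (SamePoint u v)
  SamePoint? u v = ∃? (λ k → ¬? (k ≟ 0#) ×-dec Fin.all? (λ i → v i ≟ k * u i))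

  attains⊎collides : (g : F → F) (γ : F) → (∃ λ x → g x ≡ γ) ⊎ (∃₂ λ x y → ¬ x ≡ y × g x ≡ g y)
  attains⊎collides g γ with Fin.pigeonhole (ℕ.n<1+n q) value
    where
    value : Fin (suc q) → Fin q
    value zero    = to γ
    value (suc i) = to (g (from i))
  ... | zero  , suc j , _   , e = inj₁ (from j , sym (to-injective e))
  ... | suc i , suc j , i<j , e = inj₂ (from i , from j , i≢j ∘ from-injective , to-injective e)
    where i≢j = λ i≡j → ℕ.<-irrefl (cong Fin.toℕ i≡j) (ℕ.s≤s⁻¹ i<j)

  1≢0 : ¬ 1# ≡ 0#
  1≢0 = 0≢1 ∘ sym

  x-y≡0⇒x≡y : ∀ {x y} → x + - y ≡ 0# → x ≡ y
  x-y≡0⇒x≡y = x∙y⁻¹≈ε⇒x≈y _ _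

  x*y≡0⇒x≡0⊎y≡0 : ∀ x y → x * y ≡ 0# → x ≡ 0# ⊎ y ≡ 0#
  x*y≡0⇒x≡0⊎y≡0 x y xy≡0 with x ≟ 0#
  ... | yes x≡0 = inj₁ x≡0
  ... | no  x≢0 = let x⁻¹ , xx⁻¹≡1 = inverse x x≢0 in inj₂ (begin
    y                ≡⟨ sym (*-identityʳ y) ⟩
    y * 1#           ≡⟨ cong (y *_) (sym xx⁻¹≡1) ⟩
    y * (x * x⁻¹)    ≡⟨ solve 3 (λ x y z → y :* (x :* z) := (x :* y) :* z) refl x y x⁻¹ ⟩
    (x * y) * x⁻¹    ≡⟨ cong (_* x⁻¹) xy≡0 ⟩
    0# * x⁻¹         ≡⟨ zeroˡ x⁻¹ ⟩
    0#               ∎)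

  x*y≡0⇒y≡0 : ∀ {x y} → ¬ x ≡ 0# → x * y ≡ 0# → y ≡ 0#
  x*y≡0⇒y≡0 {x} {y} x≢0 xy≡0 = [ ⊥-elim ∘ x≢0 , id ]′ (x*y≡0⇒x≡0⊎y≡0 x y xy≡0)

  x*x≡0⇒x≡0 : ∀ {x} → x * x ≡ 0# → x ≡ 0#
  x*x≡0⇒x≡0 {x} xx≡0 = reduce (x*y≡0⇒x≡0⊎y≡0 x x xx≡0)

  *-cancelˡ : ∀ {a x y} → ¬ a ≡ 0# → a * x ≡ a * y → x ≡ y
  *-cancelˡ {a} {x} {y} a≢0 ax≡ay = x-y≡0⇒x≡y (x*y≡0⇒y≡0 a≢0 (begin
    a * (x + - y)       ≡⟨ solve 3 (λ a x y → a :* (x :+ :- y) := a :* x :+ :- (a :* y)) refl a x y ⟩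
    a * x + - (a * y)   ≡⟨ cong (λ z → z + - (a * y)) ax≡ay ⟩
    a * y + - (a * y)   ≡⟨ -‿inverseʳ _ ⟩
    0#                  ∎))

  *-≢0 : ∀ {x y} → ¬ x ≡ 0# → ¬ y ≡ 0# → ¬ x * y ≡ 0#
  *-≢0 x≢0 y≢0 xy≡0 = y≢0 (x*y≡0⇒y≡0 x≢0 xy≡0)

  x*x≡y*y⇒x≡y⊎x≡-y : ∀ x y → x * x ≡ y * y → x ≡ y ⊎ x ≡ - y
  x*x≡y*y⇒x≡y⊎x≡-y x y xx≡yy with x*y≡0⇒x≡0⊎y≡0 (x + - y) (x + y) (begin
      (x + - y) * (x + y)   ≡⟨ solve 2 (λ x y → (x :+ :- y) :* (x :+ y) := x :* x :+ :- (y :* y)) refl x y ⟩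
      x * x + - (y * y)     ≡⟨ cong (λ z → z + - (y * y)) xx≡yy ⟩
      y * y + - (y * y)     ≡⟨ -‿inverseʳ _ ⟩
      0#                    ∎)
  ... | inj₁ x-y≡0 = inj₁ (x-y≡0⇒x≡y x-y≡0)
  ... | inj₂ x+y≡0 = inj₂ (x-y≡0⇒x≡y (trans (cong (x +_) (-‿involutive y)) x+y≡0))

  char2⇒-x≡x : two ≡ 0# → ∀ x → - x ≡ x
  char2⇒-x≡x 2≡0 x = sym (+-inverseʳ-unique x x (begin
    x + x     ≡⟨ solve 1 (λ x → x :+ x := κ 2 :* x) refl x ⟩
    two * x   ≡⟨ cong (_* x) 2≡0 ⟩
    0# * x    ≡⟨ zeroˡ x ⟩
    0#        ∎))

  char2⇒square : two ≡ 0# → ∀ γ → ∃ λ x → x * x ≡ γ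
  char2⇒square 2≡0 γ with attains⊎collides (λ x → x * x) γ
  ... | inj₁ root = root
  ... | inj₂ (x , y , x≢y , xx≡yy) with x*x≡y*y⇒x≡y⊎x≡-y x y xx≡yy
  ...   | inj₁ x≡y  = ⊥-elim (x≢y x≡y)
  ...   | inj₂ x≡-y = ⊥-elim (x≢y (trans x≡-y (char2⇒-x≡x 2≡0 y)))

  index : F → ℕ
  index x = Fin.toℕ (to x)

  Canonical : F → Set
  Canonical x = index x ℕ.≤ index (- x)

  canonical? : ∀ x → Dec (Canonical x)
  canonical? x = index x ℕ.≤? index (- x)

  canonical-0# : Canonical 0#
  canonical-0# = ℕ.≤-reflexive (cong index (sym -0#≈0#))

  canonical-unique : ∀ {x y} → Canonical x → Canonical y → x ≡ - y → x ≡ y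
  canonical-unique {x} {y} cx cy x≡-y = to-injective (Fin.toℕ-injective (ℕ.≤-antisym
    (subst (λ z → index x ℕ.≤ index z) (trans (cong -_ x≡-y) (-‿involutive y)) cx)
    (subst (λ z → index y ℕ.≤ index z) (sym x≡-y) cy)))

  noncanonical-unique : ∀ {x y} → ¬ Canonical x → ¬ Canonical y → ¬ x ≡ - y
  noncanonical-unique {x} {y} ¬cx ¬cy x≡-y =
    subst (λ z → ¬ index y ℕ.≤ index z) (sym x≡-y) ¬cy
      (ℕ.<⇒≤ (ℕ.≰⇒> (subst (λ z → ¬ index x ℕ.≤ index z) (trans (cong -_ x≡-y) (-‿involutive y)) ¬cx)))

  -- Pigeonhole on the map sending a canonical x to α x² and any other x to γ + x²:
  -- it is injective on canonical and on non-canonical elements, so either it takes the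
  -- value γ or it identifies some α x² with some γ + w².
  module _ {α : F} (α≢0 : ¬ α ≡ 0#) (γ : F) where
    private
      Solution : Set
      Solution = ∃₂ λ x w → α * x * x ≡ γ + w * w

      value : (x : F) → Dec (Canonical x) → F
      value x (yes _) = α * x * x
      value x (no _)  = γ + x * x

      distinct-squares : ∀ {x y} → ¬ x ≡ y → x * x ≡ y * y → ¬ (x ≡ - y → x ≡ y)
      distinct-squares {x} {y} x≢y xx≡yy unique with x*x≡y*y⇒x≡y⊎x≡-y x y xx≡yy
      ... | inj₁ x≡y  = x≢y x≡y
      ... | inj₂ x≡-y = x≢y (unique x≡-y)

      attained : ∀ x (c : Dec (Canonical x)) → value x c ≡ γ → Solution
      attained x (yes _) e = x , 0# , trans e (solve 1 (λ γ → γ := γ :+ κ 0 :* κ 0) refl γ)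
      attained x (no ¬c) e = ⊥-elim (¬c (subst Canonical (sym x≡0) canonical-0#))
        where x≡0 = x*x≡0⇒x≡0 (+-cancelˡ γ _ _ (trans e (sym (+-identityʳ γ))))

      collided : ∀ x y → ¬ x ≡ y → ∀ cx cy → value x cx ≡ value y cy → Solution
      collided x y x≢y (yes cx) (yes cy) e =
        ⊥-elim (distinct-squares x≢y (*-cancelˡ α≢0 (trans (sym (*-assoc α x x)) (trans e (*-assoc α y y)))) (canonical-unique cx cy))
      collided x y x≢y (no ¬cx) (no ¬cy) e =
        ⊥-elim (distinct-squares x≢y (+-cancelˡ γ _ _ e) (⊥-elim ∘ noncanonical-unique ¬cx ¬cy))
      collided x y _   (yes _)  (no _)   e = x , y , e
      collided x y _   (no _)   (yes _)  e = y , x , sym e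

    ∃αx²≡γ+w² : ∃₂ λ x w → α * x * x ≡ γ + w * w
    ∃αx²≡γ+w² with attains⊎collides (λ x → value x (canonical? x)) γ
    ... | inj₁ (x , e)           = attained x (canonical? x) e
    ... | inj₂ (x , y , x≢y , e) = collided x y x≢y (canonical? x) (canonical? y) e

  lc : ∀ {n} → F → V n → F → V n → V n
  lc s x t y i = s * x i + t * y i

  infixr 25 _•_
  _•_ : ∀ {n} → F → V n → V n
  (k • x) i = k * x i

  dot : ∀ {n} → V n → V n → F
  dot l y = Σᶠ (λ i → l i * y i)

  basis : ∀ {n} → Fin n → V n
  basis zero    = 1# ∷ zeroV
  basis (suc i) = 0# ∷ basis i

  ≢0⇒NonZero : ∀ {n} {v : V n} i → ¬ v i ≡ 0# → NonZero v
  ≢0⇒NonZero i vi≢0 v≐0 = vi≢0 (v≐0 i)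

  Σᶠ-cong : ∀ {n} {f g : Fin n → F} → (∀ i → f i ≡ g i) → Σᶠ f ≡ Σᶠ g
  Σᶠ-cong {zero}  f≐g = refl
  Σᶠ-cong {suc n} f≐g = cong₂ _+_ (f≐g zero) (Σᶠ-cong (f≐g ∘ suc))

  *-distribˡ-Σᶠ : ∀ {n} s (f : Fin n → F) → Σᶠ (λ i → s * f i) ≡ s * Σᶠ f
  *-distribˡ-Σᶠ {zero}  s f = sym (zeroʳ s)
  *-distribˡ-Σᶠ {suc n} s f = trans (cong (s * f zero +_) (*-distribˡ-Σᶠ s (f ∘ suc))) (sym (distribˡ s _ _))

  Σᶠ-linear : ∀ {n} s t (f g : Fin n → F) → Σᶠ (λ i → s * f i + t * g i) ≡ s * Σᶠ f + t * Σᶠ g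
  Σᶠ-linear {zero}  s t f g = solve 2 (λ s t → κ 0 := s :* κ 0 :+ t :* κ 0) refl s t
  Σᶠ-linear {suc n} s t f g = trans (cong (s * f zero + t * g zero +_) (Σᶠ-linear s t (f ∘ suc) (g ∘ suc)))
    (solve 6 (λ s t a b A B → s :* a :+ t :* b :+ (s :* A :+ t :* B) := s :* (a :+ A) :+ t :* (b :+ B))
      refl s t (f zero) (g zero) (Σᶠ (f ∘ suc)) (Σᶠ (g ∘ suc)))

  Σᶠ-linear₃ : ∀ {n} r s t (f g h : Fin n → F) →
    Σᶠ (λ i → r * f i + s * g i + t * h i) ≡ r * Σᶠ f + s * Σᶠ g + t * Σᶠ h
  Σᶠ-linear₃ {zero}  r s t f g h = solve 3 (λ r s t → κ 0 := r :* κ 0 :+ s :* κ 0 :+ t :* κ 0) refl r s t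
  Σᶠ-linear₃ {suc n} r s t f g h =
    trans (cong (r * f zero + s * g zero + t * h zero +_) (Σᶠ-linear₃ r s t (f ∘ suc) (g ∘ suc) (h ∘ suc)))
      (solve 9 (λ r s t a b d A B D →
          r :* a :+ s :* b :+ t :* d :+ (r :* A :+ s :* B :+ t :* D) := r :* (a :+ A) :+ s :* (b :+ B) :+ t :* (d :+ D))
        refl r s t (f zero) (g zero) (h zero) (Σᶠ (f ∘ suc)) (Σᶠ (g ∘ suc)) (Σᶠ (h ∘ suc)))

  apply-cong : ∀ {n m} (M : Mat n m) {x y} → x ≐ y → apply M x ≐ apply M y
  apply-cong M x≐y i = Σᶠ-cong λ j → cong (M i j *_) (x≐y j)

  apply-lc : ∀ {n m} (M : Mat n m) s x t y → apply M (lc s x t y) ≐ lc s (apply M x) t (apply M y)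
  apply-lc {m = m} M s x t y i = trans
    (Σᶠ-cong λ j → solve 5 (λ m s x t y → m :* (s :* x :+ t :* y) := s :* (m :* x) :+ t :* (m :* y)) refl (M i j) s (x j) t (y j))
    (Σᶠ-linear {m} s t _ _)

  apply-• : ∀ {n m} (M : Mat n m) k x → apply M (k • x) ≐ k • apply M x
  apply-• {m = m} M k x i = trans
    (Σᶠ-cong λ j → solve 3 (λ m k x → m :* (k :* x) := k :* (m :* x)) refl (M i j) k (x j))
    (*-distribˡ-Σᶠ {m} k _)

  apply-zero : ∀ {n m} (M : Mat n m) → apply M zeroV ≐ zeroV
  apply-zero M i = trans
    (Σᶠ-cong λ j → solve 1 (λ m → m :* κ 0 := κ 0 :* m) refl (M i j))
    (trans (*-distribˡ-Σᶠ 0# (M i)) (zeroˡ _))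

  NonZero-preimage : ∀ {n m} (M : Mat n m) {y u} → apply M y ≐ u → NonZero u → NonZero y
  NonZero-preimage M My≐u u≢0 y≐0 = u≢0 λ i → trans (sym (My≐u i)) (trans (apply-cong M y≐0 i) (apply-zero M i))

  SamePoint-apply : ∀ {n m} (M : Mat n m) {x y} → SamePoint x y → SamePoint (apply M x) (apply M y)
  SamePoint-apply M {x} (k , k≢0 , y≐kx) = k , k≢0 , λ i → trans (apply-cong M y≐kx i) (apply-• M k x i)

  SamePoint-resp-≐ : ∀ {n} {x x′ y y′ : V n} → x ≐ x′ → y ≐ y′ → SamePoint x y → SamePoint x′ y′
  SamePoint-resp-≐ x≐x′ y≐y′ (k , k≢0 , y≐kx) = k , k≢0 , λ i → trans (sym (y≐y′ i)) (trans (y≐kx i) (cong (k *_) (x≐x′ i)))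

  lc-cong : ∀ {n} s t {x x′ y y′ : V n} → x ≐ x′ → y ≐ y′ → lc s x t y ≐ lc s x′ t y′
  lc-cong s t x≐x′ y≐y′ i = cong₂ (λ u v → s * u + t * v) (x≐x′ i) (y≐y′ i)

  evalQ-cong : ∀ {n} (A : QForm n) {x y} → x ≐ y → evalQ A x ≡ evalQ A y
  evalQ-cong A x≐y = Σᶠ-cong λ i → Σᶠ-cong λ j → cong₂ (λ u v → A i j * u * v) (x≐y i) (x≐y j)

  polar : ∀ {n} → QForm n → V n → V n → F
  polar A u v = Σᶠ λ i → Σᶠ λ j → A i j * (u i * v j + v i * u j)

  evalQ-lc : ∀ {n} (A : QForm n) s u t v →
    evalQ A (lc s u t v) ≡ s * s * evalQ A u + t * t * evalQ A v + s * t * polar A u v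
  evalQ-lc {n} A s u t v = trans
    (Σᶠ-cong λ i → trans
      (Σᶠ-cong λ j → solve 7 (λ a s t uᵢ uⱼ vᵢ vⱼ →
          a :* (s :* uᵢ :+ t :* vᵢ) :* (s :* uⱼ :+ t :* vⱼ)
          := s :* s :* (a :* uᵢ :* uⱼ) :+ t :* t :* (a :* vᵢ :* vⱼ) :+ s :* t :* (a :* (uᵢ :* vⱼ :+ vᵢ :* uⱼ)))
        refl (A i j) s t (u i) (u j) (v i) (v j))
      (Σᶠ-linear₃ {n} (s * s) (t * t) (s * t) _ _ _))
    (Σᶠ-linear₃ {n} (s * s) (t * t) (s * t) _ _ _)

  polar≡0⇒LineInQuadric : ∀ {n} (A : QForm n) {u v} →
    evalQ A u ≡ 0# → evalQ A v ≡ 0# → polar A u v ≡ 0# → LineInQuadric A u v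
  polar≡0⇒LineInQuadric A {u} {v} Qu≡0 Qv≡0 B≡0 s t = begin
    evalQ A (lc s u t v)                                        ≡⟨ evalQ-lc A s u t v ⟩
    s * s * evalQ A u + t * t * evalQ A v + s * t * polar A u v ≡⟨ cong₂ (λ p q → s * s * p + t * t * evalQ A v + s * t * q) Qu≡0 B≡0 ⟩
    s * s * 0# + t * t * evalQ A v + s * t * 0#                 ≡⟨ cong (λ p → s * s * 0# + t * t * p + s * t * 0#) Qv≡0 ⟩
    s * s * 0# + t * t * 0# + s * t * 0#                        ≡⟨ solve 2 (λ s t → s :* s :* κ 0 :+ t :* t :* κ 0 :+ s :* t :* κ 0 := κ 0) refl s t ⟩
    0#                                                          ∎

  record IsLinearForm {n} (ℓ : V n → F) : Set where
    field
      resp-≐ : ∀ {x y} → x ≐ y → ℓ x ≡ ℓ y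
      linear : ∀ s x t y → ℓ (lc s x t y) ≡ s * ℓ x + t * ℓ y

  polar-linearˡ : ∀ {n} (A : QForm n) v → IsLinearForm (λ u → polar A u v)
  polar-linearˡ {n} A v = record
    { resp-≐ = λ x≐y → Σᶠ-cong λ i → Σᶠ-cong λ j → cong₂ (λ p q → A i j * (p * v j + v i * q)) (x≐y i) (x≐y j)
    ; linear = λ s x t y → trans
        (Σᶠ-cong λ i → trans
          (Σᶠ-cong λ j → solve 9 (λ a s t xᵢ xⱼ yᵢ yⱼ vᵢ vⱼ →
              a :* ((s :* xᵢ :+ t :* yᵢ) :* vⱼ :+ vᵢ :* (s :* xⱼ :+ t :* yⱼ))
              := s :* (a :* (xᵢ :* vⱼ :+ vᵢ :* xⱼ)) :+ t :* (a :* (yᵢ :* vⱼ :+ vᵢ :* yⱼ)))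
            refl (A i j) s t (x i) (x j) (y i) (y j) (v i) (v j))
          (Σᶠ-linear {n} s t _ _))
        (Σᶠ-linear {n} s t _ _)
    }

  IsLinearForm-∘apply : ∀ {n m} {ℓ : V n → F} (M : Mat n m) → IsLinearForm ℓ → IsLinearForm (λ y → ℓ (apply M y))
  IsLinearForm-∘apply M isLinear = record
    { resp-≐ = λ x≐y → resp-≐ (apply-cong M x≐y)
    ; linear = λ s x t y → trans (resp-≐ (apply-lc M s x t y)) (linear s (apply M x) t (apply M y))
    }
    where open IsLinearForm isLinear

  linearForm-expansion : ∀ {n} {ℓ : V n → F} → IsLinearForm ℓ → ∀ y → ℓ y ≡ dot (λ i → ℓ (basis i)) y
  linearForm-expansion {zero} {ℓ} isLinear y = begin
    ℓ y                   ≡⟨ resp-≐ (λ ()) ⟩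
    ℓ (lc 0# y 0# y)      ≡⟨ linear 0# y 0# y ⟩
    0# * ℓ y + 0# * ℓ y   ≡⟨ solve 1 (λ u → κ 0 :* u :+ κ 0 :* u := κ 0) refl (ℓ y) ⟩
    0#                    ∎
    where open IsLinearForm isLinear
  linearForm-expansion {suc n} {ℓ} isLinear y = begin
    ℓ y                                        ≡⟨ resp-≐ (λ { zero → y₀≡ ; (suc i) → yᵢ≡ i }) ⟩
    ℓ (lc (y zero) (basis zero) 1# (0# ∷ y ∘ suc))  ≡⟨ linear _ _ _ _ ⟩
    y zero * ℓ (basis zero) + 1# * ℓ (0# ∷ y ∘ suc) ≡⟨ cong (λ u → y zero * ℓ (basis zero) + 1# * u) (linearForm-expansion tail-linear (y ∘ suc)) ⟩
    y zero * ℓ (basis zero) + 1# * Σᶠ (λ i → ℓ (basis (suc i)) * y (suc i))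
                                               ≡⟨ solve 3 (λ y₀ l₀ S → y₀ :* l₀ :+ κ 1 :* S := l₀ :* y₀ :+ S) refl (y zero) (ℓ (basis zero)) _ ⟩
    dot (λ i → ℓ (basis i)) y                  ∎
    where
    open IsLinearForm isLinear
    y₀≡ : y zero ≡ y zero * 1# + 1# * 0#
    y₀≡ = solve 1 (λ y₀ → y₀ := y₀ :* κ 1 :+ κ 1 :* κ 0) refl (y zero)
    yᵢ≡ : ∀ i → y (suc i) ≡ y zero * 0# + 1# * y (suc i)
    yᵢ≡ i = solve 2 (λ y₀ yᵢ → yᵢ := y₀ :* κ 0 :+ κ 1 :* yᵢ) refl (y zero) (y (suc i))
    tail-linear : IsLinearForm (λ z → ℓ (0# ∷ z))
    tail-linear = record
      { resp-≐ = λ x≐y → resp-≐ λ { zero → refl ; (suc i) → x≐y i }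
      ; linear = λ s x t z → trans (resp-≐ λ { zero → solve 2 (λ s t → κ 0 := s :* κ 0 :+ t :* κ 0) refl s t ; (suc i) → refl })
                                   (linear s (0# ∷ x) t (0# ∷ z))
      }

  binaryForm : F → F → F → F → F → F
  binaryForm a b c x y = a * x * x + b * x * y + c * y * y

  linearForm₂-kernel : ∀ l₀ l₁ → Σ[ p ∈ V 2 ] NonZero p × l₀ * p (# 0) + l₁ * p (# 1) ≡ 0#
  linearForm₂-kernel l₀ l₁ with l₁ ≟ 0#
  ... | yes l₁≡0 = (0# ∷ 1# ∷ []) , ≢0⇒NonZero (# 1) 1≢0 ,
    trans (cong (λ z → l₀ * 0# + z * 1#) l₁≡0) (solve 1 (λ l → l :* κ 0 :+ κ 0 :* κ 1 := κ 0) refl l₀)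
  ... | no l₁≢0  = (l₁ ∷ - l₀ ∷ []) , ≢0⇒NonZero (# 0) l₁≢0 ,
    solve 2 (λ l₀ l₁ → l₀ :* l₁ :+ l₁ :* (:- l₀) := κ 0) refl l₀ l₁

  -- Completing the square: 4A (A x² + B x y + C y²) = (2A x + B y)² + (4AC − B²) y².
  binaryForm-square-value : ¬ two ≡ 0# → ∀ A B C →
    Σ[ p ∈ V 2 ] NonZero p × ∃ λ z → z * z ≡ binaryForm A B C (p (# 0)) (p (# 1))
  binaryForm-square-value 2≢0 A B C with A ≟ 0#
  ... | yes A≡0 = (1# ∷ 0# ∷ []) , ≢0⇒NonZero (# 0) 1≢0 , 0# , (begin
    0# * 0#                                  ≡⟨ solve 2 (λ B C → κ 0 :* κ 0 := κ 0 :* κ 1 :* κ 1 :+ B :* κ 1 :* κ 0 :+ C :* κ 0 :* κ 0) refl B C ⟩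
    binaryForm 0# B C 1# 0#                  ≡⟨ cong (λ A → binaryForm A B C 1# 0#) (sym A≡0) ⟩
    binaryForm A B C 1# 0#                   ∎)
  ... | no A≢0 with ∃αx²≡γ+w² (*-≢0 (*-≢0 2≢0 2≢0) A≢0) (two * two * A * C + - (B * B))
  ...   | x , w , 4Ax²≡γ+w² = (w + - B ∷ two * A ∷ []) , ≢0⇒NonZero (# 1) (*-≢0 2≢0 A≢0) , two * A * x , (begin
    (two * A * x) * (two * A * x)                        ≡⟨ solve 2 (λ A x → (κ 2 :* A :* x) :* (κ 2 :* A :* x) := A :* (κ 2 :* κ 2 :* A :* x :* x)) refl A x ⟩
    A * (two * two * A * x * x)                          ≡⟨ cong (A *_) 4Ax²≡γ+w² ⟩
    A * (two * two * A * C + - (B * B) + w * w)          ≡⟨ solve 4 (λ A B C w → A :* (κ 2 :* κ 2 :* A :* C :+ :- (B :* B) :+ w :* w) :=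
                                                              A :* (w :+ :- B) :* (w :+ :- B) :+ B :* (w :+ :- B) :* (κ 2 :* A) :+ C :* (κ 2 :* A) :* (κ 2 :* A)) refl A B C w ⟩
    binaryForm A B C (w + - B) (two * A)                 ∎)

  ellipticForm : F → F → F → V 4 → F
  ellipticForm a b c y = y (# 0) * y (# 1) + a * y (# 2) * y (# 2) + b * y (# 2) * y (# 3) + c * y (# 3) * y (# 3)

  module _ (a b c : F) where

    -- In the plane l·y = 0 of F⁴ with l₀ l₁ ≠ 0, the point
    -- (l₁ t₀, −(l₀ t₀ + l₂ t₁ + l₃ t₂), l₁ t₁, l₁ t₂) has ellipticForm equal to −l₁ · sectionForm l t.
    sectionForm : V 4 → V 3 → F
    sectionForm l t = l (# 0) * t (# 0) * t (# 0) + (l (# 2) * t (# 1) + l (# 3) * t (# 2)) * t (# 0)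
                      + - (l (# 1) * binaryForm a b c (t (# 1)) (t (# 2)))

    sectionForm-isotropic-char2 : two ≡ 0# → ∀ l → ¬ l (# 0) ≡ 0# → Σ[ t ∈ V 3 ] NonZero t × sectionForm l t ≡ 0#
    sectionForm-isotropic-char2 2≡0 l l₀≢0 with linearForm₂-kernel (l (# 2)) (l (# 3))
    ... | p , p≢0 , l₂p₀+l₃p₁≡0 with char2⇒square 2≡0 (l (# 0) * l (# 1) * binaryForm a b c (p (# 0)) (p (# 1)))
    ...   | x , xx≡ = (x ∷ l₀ * p₀ ∷ l₀ * p₁ ∷ []) , t≢0 , (begin
      sectionForm l (x ∷ l₀ * p₀ ∷ l₀ * p₁ ∷ [])
        ≡⟨ solve 10 (λ l₀ l₁ l₂ l₃ a b c x p₀ p₁ →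
             l₀ :* x :* x :+ (l₂ :* (l₀ :* p₀) :+ l₃ :* (l₀ :* p₁)) :* x
               :+ :- (l₁ :* (a :* (l₀ :* p₀) :* (l₀ :* p₀) :+ b :* (l₀ :* p₀) :* (l₀ :* p₁) :+ c :* (l₀ :* p₁) :* (l₀ :* p₁)))
           := l₀ :* (x :* x) :+ l₀ :* (l₂ :* p₀ :+ l₃ :* p₁) :* x
               :+ :- (l₀ :* (l₀ :* l₁ :* (a :* p₀ :* p₀ :+ b :* p₀ :* p₁ :+ c :* p₁ :* p₁))))
           refl l₀ (l (# 1)) (l (# 2)) (l (# 3)) a b c x p₀ p₁ ⟩
      l₀ * (x * x) + l₀ * (l (# 2) * p₀ + l (# 3) * p₁) * x + - (l₀ * Q)
        ≡⟨ cong₂ (λ u v → l₀ * u + l₀ * v * x + - (l₀ * Q)) xx≡ l₂p₀+l₃p₁≡0 ⟩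
      l₀ * Q + l₀ * 0# * x + - (l₀ * Q)
        ≡⟨ solve 3 (λ l₀ Q x → l₀ :* Q :+ l₀ :* κ 0 :* x :+ :- (l₀ :* Q) := κ 0) refl l₀ Q x ⟩
      0# ∎)
      where
      l₀ = l (# 0)
      p₀ = p (# 0)
      p₁ = p (# 1)
      Q = l₀ * l (# 1) * binaryForm a b c p₀ p₁
      t≢0 : NonZero (x ∷ l₀ * p₀ ∷ l₀ * p₁ ∷ [])
      t≢0 t≐0 = p≢0 λ { zero → x*y≡0⇒y≡0 l₀≢0 (t≐0 (# 1)) ; (suc zero) → x*y≡0⇒y≡0 l₀≢0 (t≐0 (# 2)) }

    -- Completing the square in t₀ leaves the binary form (l₂ t₁ + l₃ t₂)² + 4 l₀ l₁ f(t₁, t₂).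
    sectionForm-isotropic-odd : ¬ two ≡ 0# → ∀ l → ¬ l (# 0) ≡ 0# → Σ[ t ∈ V 3 ] NonZero t × sectionForm l t ≡ 0#
    sectionForm-isotropic-odd 2≢0 l l₀≢0
      with binaryForm-square-value 2≢0 (l₂ * l₂ + two * two * l₀ * l₁ * a) (two * l₂ * l₃ + two * two * l₀ * l₁ * b)
                                 (l₃ * l₃ + two * two * l₀ * l₁ * c)
      where l₀ = l (# 0); l₁ = l (# 1); l₂ = l (# 2); l₃ = l (# 3)
    ... | p , p≢0 , z , zz≡ = t , t≢0 , (begin
      sectionForm l t
        ≡⟨ solve 10 (λ l₀ l₁ l₂ l₃ a b c z p₀ p₁ →
             let s = l₂ :* p₀ :+ l₃ :* p₁ in
             l₀ :* (z :+ :- s) :* (z :+ :- s) :+ (l₂ :* (κ 2 :* l₀ :* p₀) :+ l₃ :* (κ 2 :* l₀ :* p₁)) :* (z :+ :- s)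
               :+ :- (l₁ :* (a :* (κ 2 :* l₀ :* p₀) :* (κ 2 :* l₀ :* p₀) :+ b :* (κ 2 :* l₀ :* p₀) :* (κ 2 :* l₀ :* p₁)
                             :+ c :* (κ 2 :* l₀ :* p₁) :* (κ 2 :* l₀ :* p₁)))
           := l₀ :* (z :* z :+ :- ((l₂ :* l₂ :+ κ 2 :* κ 2 :* l₀ :* l₁ :* a) :* p₀ :* p₀
                                 :+ (κ 2 :* l₂ :* l₃ :+ κ 2 :* κ 2 :* l₀ :* l₁ :* b) :* p₀ :* p₁
                                 :+ (l₃ :* l₃ :+ κ 2 :* κ 2 :* l₀ :* l₁ :* c) :* p₁ :* p₁)))
           refl l₀ l₁ l₂ l₃ a b c z p₀ p₁ ⟩
      l₀ * (z * z + - Q)   ≡⟨ cong (λ u → l₀ * (u + - Q)) zz≡ ⟩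
      l₀ * (Q + - Q)       ≡⟨ solve 2 (λ l₀ Q → l₀ :* (Q :+ :- Q) := κ 0) refl l₀ Q ⟩
      0#                   ∎)
      where
      l₀ = l (# 0); l₁ = l (# 1); l₂ = l (# 2); l₃ = l (# 3)
      p₀ = p (# 0); p₁ = p (# 1)
      Q = binaryForm (l₂ * l₂ + two * two * l₀ * l₁ * a) (two * l₂ * l₃ + two * two * l₀ * l₁ * b)
                     (l₃ * l₃ + two * two * l₀ * l₁ * c) p₀ p₁
      t : V 3
      t = z + - (l₂ * p₀ + l₃ * p₁) ∷ two * l₀ * p₀ ∷ two * l₀ * p₁ ∷ []
      t≢0 : NonZero t
      t≢0 t≐0 = p≢0 λ { zero → x*y≡0⇒y≡0 (*-≢0 2≢0 l₀≢0) (t≐0 (# 1)) ; (suc zero) → x*y≡0⇒y≡0 (*-≢0 2≢0 l₀≢0) (t≐0 (# 2)) }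

    sectionForm-isotropic : ∀ l → ¬ l (# 0) ≡ 0# → Σ[ t ∈ V 3 ] NonZero t × sectionForm l t ≡ 0#
    sectionForm-isotropic l with two ≟ 0#
    ... | yes 2≡0 = sectionForm-isotropic-char2 2≡0 l
    ... | no 2≢0  = sectionForm-isotropic-odd 2≢0 l

    plane-meets-ellipticForm : ∀ l → Σ[ y ∈ V 4 ] NonZero y × ellipticForm a b c y ≡ 0# × dot l y ≡ 0#
    plane-meets-ellipticForm l with l (# 0) ≟ 0# | l (# 1) ≟ 0#
    ... | yes l₀≡0 | _ = (1# ∷ 0# ∷ 0# ∷ 0# ∷ []) , ≢0⇒NonZero (# 0) 1≢0 ,
      solve 3 (λ a b c → κ 1 :* κ 0 :+ a :* κ 0 :* κ 0 :+ b :* κ 0 :* κ 0 :+ c :* κ 0 :* κ 0 := κ 0) refl a b c ,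
      trans (solve 4 (λ l₀ l₁ l₂ l₃ → l₀ :* κ 1 :+ (l₁ :* κ 0 :+ (l₂ :* κ 0 :+ (l₃ :* κ 0 :+ κ 0))) := l₀) refl
                     (l (# 0)) (l (# 1)) (l (# 2)) (l (# 3))) l₀≡0
    ... | no _ | yes l₁≡0 = (0# ∷ 1# ∷ 0# ∷ 0# ∷ []) , ≢0⇒NonZero (# 1) 1≢0 ,
      solve 3 (λ a b c → κ 0 :* κ 1 :+ a :* κ 0 :* κ 0 :+ b :* κ 0 :* κ 0 :+ c :* κ 0 :* κ 0 := κ 0) refl a b c ,
      trans (solve 4 (λ l₀ l₁ l₂ l₃ → l₀ :* κ 0 :+ (l₁ :* κ 1 :+ (l₂ :* κ 0 :+ (l₃ :* κ 0 :+ κ 0))) := l₁) refl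
                     (l (# 0)) (l (# 1)) (l (# 2)) (l (# 3))) l₁≡0
    ... | no l₀≢0 | no l₁≢0 with sectionForm-isotropic l l₀≢0
    ...   | t , t≢0 , T≡0 = y , y≢0 , (begin
      ellipticForm a b c y
        ≡⟨ solve 10 (λ l₀ l₁ l₂ l₃ a b c t₀ t₁ t₂ →
             (l₁ :* t₀) :* (:- (l₀ :* t₀ :+ (l₂ :* t₁ :+ l₃ :* t₂))) :+ a :* (l₁ :* t₁) :* (l₁ :* t₁)
               :+ b :* (l₁ :* t₁) :* (l₁ :* t₂) :+ c :* (l₁ :* t₂) :* (l₁ :* t₂)
           := :- (l₁ :* (l₀ :* t₀ :* t₀ :+ (l₂ :* t₁ :+ l₃ :* t₂) :* t₀
                          :+ :- (l₁ :* (a :* t₁ :* t₁ :+ b :* t₁ :* t₂ :+ c :* t₂ :* t₂)))))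
           refl l₀ l₁ l₂ l₃ a b c t₀ t₁ t₂ ⟩
      - (l₁ * sectionForm l t)  ≡⟨ cong (λ u → - (l₁ * u)) T≡0 ⟩
      - (l₁ * 0#)               ≡⟨ solve 1 (λ l₁ → :- (l₁ :* κ 0) := κ 0) refl l₁ ⟩
      0#                        ∎) ,
      solve 7 (λ l₀ l₁ l₂ l₃ t₀ t₁ t₂ →
        l₀ :* (l₁ :* t₀) :+ (l₁ :* (:- (l₀ :* t₀ :+ (l₂ :* t₁ :+ l₃ :* t₂))) :+ (l₂ :* (l₁ :* t₁) :+ (l₃ :* (l₁ :* t₂) :+ κ 0)))
          := κ 0) refl l₀ l₁ l₂ l₃ t₀ t₁ t₂
      where
      l₀ = l (# 0); l₁ = l (# 1); l₂ = l (# 2); l₃ = l (# 3)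
      t₀ = t (# 0); t₁ = t (# 1); t₂ = t (# 2)
      y : V 4
      y = l₁ * t₀ ∷ - (l₀ * t₀ + (l₂ * t₁ + l₃ * t₂)) ∷ l₁ * t₁ ∷ l₁ * t₂ ∷ []
      y≢0 : NonZero y
      y≢0 y≐0 = t≢0 λ { zero → x*y≡0⇒y≡0 l₁≢0 (y≐0 (# 0))
                      ; (suc zero) → x*y≡0⇒y≡0 l₁≢0 (y≐0 (# 2))
                      ; (suc (suc zero)) → x*y≡0⇒y≡0 l₁≢0 (y≐0 (# 3)) }

    ellipticForm-cong : ∀ x y → x ≐ y → ellipticForm a b c x ≡ ellipticForm a b c y
    ellipticForm-cong x y x≐y = trans
      (cong₂ (λ u v → ellipticForm a b c (u ∷ v ∷ x (# 2) ∷ x (# 3) ∷ [])) (x≐y (# 0)) (x≐y (# 1)))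
      (cong₂ (λ u v → ellipticForm a b c (y (# 0) ∷ y (# 1) ∷ u ∷ v ∷ [])) (x≐y (# 2)) (x≐y (# 3)))

    LineOnEllipticForm : V 4 → V 4 → Set
    LineOnEllipticForm x y = ∀ s t → ellipticForm a b c (lc s x t y) ≡ 0#

    line⇒ellipticForm≡0 : ∀ x y → LineOnEllipticForm x y → ellipticForm a b c x ≡ 0#
    line⇒ellipticForm≡0 x y line =
      trans (ellipticForm-cong x (lc 1# x 0# y) (λ i → solve 2 (λ x y → x := κ 1 :* x :+ κ 0 :* y) refl (x i) (y i))) (line 1# 0#)

    swap₀₁ : V 4 → V 4
    swap₀₁ y = y (# 1) ∷ y (# 0) ∷ y (# 2) ∷ y (# 3) ∷ []

    ellipticForm-swap₀₁ : ∀ y → ellipticForm a b c (swap₀₁ y) ≡ ellipticForm a b c y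
    ellipticForm-swap₀₁ y = solve 7 (λ y₀ y₁ y₂ y₃ a b c →
        y₁ :* y₀ :+ a :* y₂ :* y₂ :+ b :* y₂ :* y₃ :+ c :* y₃ :* y₃ := y₀ :* y₁ :+ a :* y₂ :* y₂ :+ b :* y₂ :* y₃ :+ c :* y₃ :* y₃)
      refl (y (# 0)) (y (# 1)) (y (# 2)) (y (# 3)) a b c

    NonZero-swap₀₁ : ∀ {y} → NonZero y → NonZero (swap₀₁ y)
    NonZero-swap₀₁ y≢0 sy≐0 = y≢0 λ { zero → sy≐0 (# 1) ; (suc zero) → sy≐0 (# 0)
                                     ; (suc (suc zero)) → sy≐0 (# 2) ; (suc (suc (suc zero))) → sy≐0 (# 3) }

    SamePoint-swap₀₁ : ∀ {x y} → SamePoint (swap₀₁ x) (swap₀₁ y) → SamePoint x y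
    SamePoint-swap₀₁ (k , k≢0 , e) = k , k≢0 , λ { zero → e (# 1) ; (suc zero) → e (# 0)
                                                  ; (suc (suc zero)) → e (# 2) ; (suc (suc (suc zero))) → e (# 3) }

    module _ (aniso : Anisotropic a b c) where

      ellipticForm≡0⇒x₂≡x₃≡0 : ∀ x → x (# 0) ≡ 0# → ellipticForm a b c x ≡ 0# → x (# 2) ≡ 0# × x (# 3) ≡ 0#
      ellipticForm≡0⇒x₂≡x₃≡0 x x₀≡0 Gx≡0 = aniso x₂ x₃ (begin
        binaryForm a b c x₂ x₃                        ≡⟨ solve 6 (λ x₁ x₂ x₃ a b c →
                                                           a :* x₂ :* x₂ :+ b :* x₂ :* x₃ :+ c :* x₃ :* x₃
                                                           := κ 0 :* x₁ :+ a :* x₂ :* x₂ :+ b :* x₂ :* x₃ :+ c :* x₃ :* x₃)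
                                                         refl (x (# 1)) x₂ x₃ a b c ⟩
        ellipticForm a b c (0# ∷ x (# 1) ∷ x₂ ∷ x₃ ∷ [])  ≡⟨ cong (λ u → ellipticForm a b c (u ∷ x (# 1) ∷ x₂ ∷ x₃ ∷ [])) (sym x₀≡0) ⟩
        ellipticForm a b c x                          ≡⟨ Gx≡0 ⟩
        0#                                            ∎)
        where x₂ = x (# 2); x₃ = x (# 3)

      -- w = x₀ y − y₀ x lies on the line and has w₀ = 0, so anisotropy kills w₂ and w₃;
      -- then ellipticForm (x + w) = x₀ w₁ kills w₁, and w = 0 says y is a multiple of x.
      line⇒SamePoint₀ : ∀ {x y} → ¬ x (# 0) ≡ 0# → NonZero y → LineOnEllipticForm x y → SamePoint x y
      line⇒SamePoint₀ {x} {y} x₀≢0 y≢0 line = k , k≢0 , y≐kx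
        where
        x₀ = x (# 0); y₀ = y (# 0)
        w : V 4
        w = lc (- y₀) x x₀ y
        w₀≡0 : w (# 0) ≡ 0#
        w₀≡0 = solve 2 (λ x₀ y₀ → :- y₀ :* x₀ :+ x₀ :* y₀ := κ 0) refl x₀ y₀
        w₂₃≡0 : w (# 2) ≡ 0# × w (# 3) ≡ 0#
        w₂₃≡0 = ellipticForm≡0⇒x₂≡x₃≡0 w w₀≡0 (line (- y₀) x₀)
        x+w : ∀ i → lc (1# + - y₀) x x₀ y i ≡ x i + w i
        x+w i = solve 4 (λ y₀ x₀ xᵢ yᵢ → (κ 1 :+ :- y₀) :* xᵢ :+ x₀ :* yᵢ := xᵢ :+ (:- y₀ :* xᵢ :+ x₀ :* yᵢ))
                  refl y₀ x₀ (x i) (y i)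
        x+0 : ∀ i → w i ≡ 0# → x i ≡ lc (1# + - y₀) x x₀ y i
        x+0 i wᵢ≡0 = sym (trans (x+w i) (trans (cong (x i +_) wᵢ≡0) (+-identityʳ _)))
        w₁≡0 : w (# 1) ≡ 0#
        w₁≡0 = x*y≡0⇒y≡0 x₀≢0 (begin
          x₀ * w (# 1)                                  ≡⟨ sym (+-identityˡ _) ⟩
          0# + x₀ * w (# 1)                             ≡⟨ cong (_+ x₀ * w (# 1)) (sym (line⇒ellipticForm≡0 x y line)) ⟩
          ellipticForm a b c x + x₀ * w (# 1)           ≡⟨ solve 8 (λ x₀ x₁ x₂ x₃ w₁ a b c →
                                                             x₀ :* x₁ :+ a :* x₂ :* x₂ :+ b :* x₂ :* x₃ :+ c :* x₃ :* x₃ :+ x₀ :* w₁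
                                                             := x₀ :* (x₁ :+ w₁) :+ a :* x₂ :* x₂ :+ b :* x₂ :* x₃ :+ c :* x₃ :* x₃)
                                                           refl x₀ (x (# 1)) (x (# 2)) (x (# 3)) (w (# 1)) a b c ⟩
          ellipticForm a b c (x₀ ∷ x (# 1) + w (# 1) ∷ x (# 2) ∷ x (# 3) ∷ [])
            ≡⟨ ellipticForm-cong (x₀ ∷ x (# 1) + w (# 1) ∷ x (# 2) ∷ x (# 3) ∷ []) (lc (1# + - y₀) x x₀ y) (λ { zero → x+0 (# 0) w₀≡0 ; (suc zero) → sym (x+w (# 1))
                                    ; (suc (suc zero)) → x+0 (# 2) (proj₁ w₂₃≡0)
                                    ; (suc (suc (suc zero))) → x+0 (# 3) (proj₂ w₂₃≡0) }) ⟩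
          ellipticForm a b c (lc (1# + - y₀) x x₀ y)    ≡⟨ line _ _ ⟩
          0#                                            ∎)
        w≐0 : w ≐ zeroV
        w≐0 = λ { zero → w₀≡0 ; (suc zero) → w₁≡0 ; (suc (suc zero)) → proj₁ w₂₃≡0 ; (suc (suc (suc zero))) → proj₂ w₂₃≡0 }
        x₀⁻¹ = proj₁ (inverse x₀ x₀≢0)
        k = y₀ * x₀⁻¹
        y≐kx : ∀ i → y i ≡ k * x i
        y≐kx i = begin
          y i                       ≡⟨ sym (*-identityʳ _) ⟩
          y i * 1#                  ≡⟨ cong (y i *_) (sym (proj₂ (inverse x₀ x₀≢0))) ⟩
          y i * (x₀ * x₀⁻¹)         ≡⟨ solve 5 (λ yᵢ xᵢ x₀ y₀ z → yᵢ :* (x₀ :* z) := (:- y₀ :* xᵢ :+ x₀ :* yᵢ) :* z :+ y₀ :* z :* xᵢ)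
                                         refl (y i) (x i) x₀ y₀ x₀⁻¹ ⟩
          w i * x₀⁻¹ + k * x i      ≡⟨ cong (λ u → u * x₀⁻¹ + k * x i) (w≐0 i) ⟩
          0# * x₀⁻¹ + k * x i       ≡⟨ solve 2 (λ z u → κ 0 :* z :+ u := u) refl x₀⁻¹ (k * x i) ⟩
          k * x i                   ∎
        k≢0 : ¬ k ≡ 0#
        k≢0 k≡0 = y≢0 λ i → trans (y≐kx i) (trans (cong (_* x i) k≡0) (zeroˡ _))

      line⇒SamePoint : ∀ {x y} → NonZero x → NonZero y → LineOnEllipticForm x y → SamePoint x y
      line⇒SamePoint {x} {y} x≢0 y≢0 line with x (# 0) ≟ 0# | x (# 1) ≟ 0#
      ... | no x₀≢0  | _        = line⇒SamePoint₀ x₀≢0 y≢0 line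
      ... | yes _    | no x₁≢0  = SamePoint-swap₀₁
        (line⇒SamePoint₀ x₁≢0 (NonZero-swap₀₁ y≢0) λ s t → trans (ellipticForm-swap₀₁ (lc s x t y)) (line s t))
      ... | yes x₀≡0 | yes x₁≡0 = ⊥-elim (x≢0 λ { zero → x₀≡0 ; (suc zero) → x₁≡0
                                                 ; (suc (suc zero)) → proj₁ x₂₃≡0 ; (suc (suc (suc zero))) → proj₂ x₂₃≡0 })
        where x₂₃≡0 = ellipticForm≡0⇒x₂≡x₃≡0 x x₀≡0 (line⇒ellipticForm≡0 x y line)

  module _ (A : QForm 8) (E : Mat 8 4) (solid : IsSolid E)
           (N N⁻¹ : Mat 4 4) (NN⁻¹ : ∀ y → apply N (apply N⁻¹ y) ≐ y) (N⁻¹N : ∀ y → apply N⁻¹ (apply N y) ≐ y)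
           (a b c : F) (aniso : Anisotropic a b c)
           (restriction : ∀ y → evalQ A (apply E (apply N y)) ≡ ellipticForm a b c y) where

    ι : V 4 → V 8
    ι y = apply E (apply N y)

    ι-lc : ∀ s x t y → ι (lc s x t y) ≐ lc s (ι x) t (ι y)
    ι-lc s x t y i = trans (apply-cong E (apply-lc N s x t y) i) (apply-lc E s (apply N x) t (apply N y) i)

    ι-• : ∀ k y → ι (k • y) ≐ k • ι y
    ι-• k y i = trans (apply-cong E (apply-• N k y) i) (apply-• E k (apply N y) i)

    ι-NonZero : ∀ {y} → NonZero y → NonZero (ι y)
    ι-NonZero {y} y≢0 ιy≐0 = y≢0 λ i →
      trans (sym (N⁻¹N y i)) (trans (apply-cong N⁻¹ (solid (apply N y) ιy≐0) i) (apply-zero N⁻¹ i))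

    ι-NonZero⁻ : ∀ {y u} → ι y ≐ u → NonZero u → NonZero y
    ι-NonZero⁻ ιy≐u u≢0 = NonZero-preimage N (λ _ → refl) (NonZero-preimage E ιy≐u u≢0)

    solidSection-coordinates : ∀ {u} → SolidSection A E u → Σ[ y ∈ V 4 ] ι y ≐ u
    solidSection-coordinates ((z , Ez≐u) , _) = apply N⁻¹ z , λ i → trans (apply-cong E (NN⁻¹ z) i) (Ez≐u i)

    ι-SolidSection : ∀ {y} → NonZero y → ellipticForm a b c y ≡ 0# → SolidSection A E (ι y)
    ι-SolidSection {y} y≢0 Gy≡0 = (apply N y , λ _ → refl) , ι-NonZero y≢0 , trans (restriction y) Gy≡0

    solidSection-partialOvoid : PartialOvoid A (SolidSection A E)
    solidSection-partialOvoid = (λ _ → proj₂) , noLine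
      where
      noLine : ∀ u v → SolidSection A E u → SolidSection A E v → ¬ SamePoint u v → ¬ LineInQuadric A u v
      noLine u v Pu Pv ¬same line with solidSection-coordinates Pu | solidSection-coordinates Pv
      ... | x , ιx≐u | y , ιy≐v =
        ¬same (SamePoint-resp-≐ ιx≐u ιy≐v (SamePoint-apply E (SamePoint-apply N
          (line⇒SamePoint a b c aniso {x} {y} (ι-NonZero⁻ ιx≐u (proj₁ (proj₂ Pu))) (ι-NonZero⁻ ιy≐v (proj₁ (proj₂ Pv))) line′))))
        where
        line′ : LineOnEllipticForm a b c x y
        line′ s t = begin
          ellipticForm a b c (lc s x t y)   ≡⟨ sym (restriction (lc s x t y)) ⟩
          evalQ A (ι (lc s x t y))          ≡⟨ evalQ-cong A {ι (lc s x t y)} {lc s u t v} (λ i → trans (ι-lc s x t y i) (lc-cong s t ιx≐u ιy≐v i)) ⟩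
          evalQ A (lc s u t v)              ≡⟨ line s t ⟩
          0#                                ∎

    polar-meets-solidSection : ∀ v → Σ[ y ∈ V 4 ] NonZero y × ellipticForm a b c y ≡ 0# × polar A (ι y) v ≡ 0#
    polar-meets-solidSection v =
      let y , y≢0 , Gy≡0 , y∈plane = plane-meets-ellipticForm a b c (λ i → ℓ (basis i))
      in y , y≢0 , Gy≡0 , trans (linearForm-expansion {ℓ = ℓ} ℓ-linear y) y∈plane
      where
      ℓ : V 4 → F
      ℓ y = polar A (ι y) v
      ℓ-linear : IsLinearForm ℓ
      ℓ-linear = IsLinearForm-∘apply N (IsLinearForm-∘apply E (polar-linearˡ A v))

    solidSection-maximal : MaximalPartialOvoid A (SolidSection A E)
    solidSection-maximal = solidSection-partialOvoid , maximal
      where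
      maximal : (P′ : PointSet 8) → (∀ v → SolidSection A E v → P′ v) → PartialOvoid A P′ → ∀ v → P′ v → SolidSection A E v
      maximal P′ P⊆P′ (onQuadric , noLine) v P′v =
        let y , y≢0 , Gy≡0 , polar≡0 = polar-meets-solidSection v
        in case SamePoint? (ι y) v of λ where
          (yes (k , _ , v≐kιy)) → (apply N (k • y) , λ i → trans (ι-• k y i) (sym (v≐kιy i))) , onQuadric v P′v
          (no ¬same)            → ⊥-elim (noLine (ι y) v (P⊆P′ (ι y) (ι-SolidSection y≢0 Gy≡0)) P′v ¬same
            (polar≡0⇒LineInQuadric A {ι y} {v} (trans (restriction y) Gy≡0) (proj₂ (onQuadric v P′v)) polar≡0))

lemma4p7 : (𝔽 : FiniteField) → let open Geometry 𝔽 in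
    (A : QForm 8) → IsHyperbolic7 A →
    (E : Mat 8 4) → IsSolid E → MeetsInElliptic A E →
    MaximalPartialOvoid A (SolidSection A E)
lemma4p7 𝔽 A _ E solid (N , (N⁻¹ , NN⁻¹ , N⁻¹N) , a , b , c , aniso , restriction) =
  solidSection-maximal 𝔽 A E solid N N⁻¹ NN⁻¹ N⁻¹N a b c aniso restriction
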